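{- Let $m\ge1$ and $W=W^{(m)}_4$. Then $W\setminus(A_0\cup A_1)=\{(0,0,\gamma_2,\gamma_3)\in W\}$, i.e., the set of $\gamma\in W$ with $\gamma_1=0$.
   Context: $W^{(m)}_4$ is the set of sequences $\gamma=(\gamma_0,\gamma_1,\gamma_2,\gamma_3)$ of nonnegative integers with $\gamma_0=0$ and $\gamma_i\le\gamma_{i-1}+m$ for $i=1,2,3$. For $\gamma\in W$, let $r=r(\gamma)$ be the least $i\in\{2,3\}$ with $\gamma_i-\gamma_{i-2}\le m$, or $r=4$ if none exists. $A_0$ is the set of $\gamma\in W$ with $\gamma_{r-1}-1\le\gamma_3+m$ and $\gamma_1>0$. $A_1=\{(0,\gamma_1,\gamma_2,\gamma_3)\in W:\gamma_2-\gamma_3>m+1\}$. -}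

module Defs where

open import Data.Nat using (ℕ; zero; suc; _+_; _∸_; _≤_; _<_; _≤?_)
open import Data.Product using (_×_)
open import Relation.Nullary using (yes; no)

record Seq4 : Set where
  constructor ⟨_,_,_,_⟩
  field
    g0 g1 g2 g3 : ℕ

open Seq4 public

-- γ_i for i ∈ {0,1,2,3}  (indices ≥ 3 are sent to γ₃; only 0..3 are used)
at : Seq4 → ℕ → ℕ
at γ 0 = g0 γ
at γ 1 = g1 γ
at γ 2 = g2 γ
at γ _ = g3 γ

InW : ℕ → Seq4 → Set
InW m γ = (g0 γ ≡0) × (g1 γ ≤ g0 γ + m) × (g2 γ ≤ g1 γ + m) × (g3 γ ≤ g2 γ + m)
  where
  open import Relation.Binary.PropositionalEquality using (_≡_)
  _≡0 : ℕ → Set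
  n ≡0 = n ≡ 0

-- r(γ): least i ∈ {2,3} with γᵢ - γᵢ₋₂ ≤ m (integer difference, i.e. γᵢ ≤ γᵢ₋₂ + m),
-- or 4 if none exists.
r : ℕ → Seq4 → ℕ
r m γ with g2 γ ≤? g0 γ + m
... | yes _ = 2
... | no _ with g3 γ ≤? g1 γ + m
...   | yes _ = 3
...   | no _ = 4

-- A₀ : γ ∈ W, γ_{r-1} - 1 ≤ γ₃ + m  (as integers; equivalently γ_{r-1} ≤ γ₃ + m + 1),
-- and γ₁ > 0.
A0 : ℕ → Seq4 → Set
A0 m γ = InW m γ × (at γ (r m γ ∸ 1) ≤ g3 γ + m + 1) × (0 < g1 γ)

A1 : ℕ → Seq4 → Set
A1 m γ = InW m γ × (g3 γ + m + 1 < g2 γ)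

-- When γ₁ > 0 the condition of A₀ can only fail for r = 3, i.e. when γ₂ > γ₃ + m + 1,
-- which is exactly A₁; when γ₁ = 0, A₀ fails by definition and A₁ fails because γ₂ ≤ m.
module Submission where

open import Defs
open import Data.Nat using (ℕ; _≤_; _<_; _≤?_; _≟_; _+_)
open import Data.Nat.Properties using (m≤m+n; ≰⇒>; <⇒≱; m≤n⇒m≤o+n; m≤n⇒m≤n+o; n≢0⇒n>0; <-irrefl)
open import Data.Product using (_×_; _,_)
open import Data.Sum using (_⊎_; inj₁; inj₂; [_,_]′)
open import Data.Empty using (⊥-elim)
open import Function using (_∘_)
open import Relation.Nullary using (¬_; yes; no)
open import Relation.Binary.PropositionalEquality using (_≡_; refl; sym)

m≤n⇒m≤o+n+1 : ∀ {m n} o → m ≤ n → m ≤ o + n + 1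
m≤n⇒m≤o+n+1 o = m≤n⇒m≤n+o 1 ∘ m≤n⇒m≤o+n o

InW∧g1>0⇒A0⊎A1 : ∀ m γ → InW m γ → 0 < g1 γ → A0 m γ ⊎ A1 m γ
InW∧g1>0⇒A0⊎A1 m γ w@(refl , g1≤m , _) g1>0 with g2 γ ≤? 0 + m
... | yes _ = inj₁ (w , m≤n⇒m≤o+n+1 (g3 γ) g1≤m , g1>0)
... | no _ with g3 γ ≤? g1 γ + m
...   | no _ = inj₁ (w , m≤n⇒m≤n+o 1 (m≤m+n (g3 γ) m) , g1>0)
...   | yes _ with g2 γ ≤? g3 γ + m + 1
...     | yes g2≤ = inj₁ (w , g2≤ , g1>0)
...     | no g2≰ = inj₂ (w , ≰⇒> g2≰)

g1≡0⇒¬A0 : ∀ m γ → g1 γ ≡ 0 → ¬ A0 m γ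
g1≡0⇒¬A0 m γ g1≡0 (_ , _ , g1>0) = <-irrefl (sym g1≡0) g1>0

InW∧g1≡0⇒¬A1 : ∀ m γ → InW m γ → g1 γ ≡ 0 → ¬ A1 m γ
InW∧g1≡0⇒¬A1 m γ (refl , _ , g2≤g1+m , _) g1≡0 (_ , g2>) rewrite g1≡0 =
  <⇒≱ g2> (m≤n⇒m≤o+n+1 (g3 γ) g2≤g1+m)

lemma4p2 : (m : ℕ) → 1 ≤ m → (γ : Seq4) →
    ((InW m γ × ¬ A0 m γ × ¬ A1 m γ) → (InW m γ × g1 γ ≡ 0))
    × ((InW m γ × g1 γ ≡ 0) → (InW m γ × ¬ A0 m γ × ¬ A1 m γ))
lemma4p2 m _ γ = outside⇒g1≡0 , g1≡0⇒outside
  where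
  outside⇒g1≡0 : InW m γ × ¬ A0 m γ × ¬ A1 m γ → InW m γ × g1 γ ≡ 0
  outside⇒g1≡0 (w , ¬a0 , ¬a1) with g1 γ ≟ 0
  ... | yes g1≡0 = w , g1≡0
  ... | no g1≢0 = ⊥-elim ([ ¬a0 , ¬a1 ]′ (InW∧g1>0⇒A0⊎A1 m γ w (n≢0⇒n>0 g1≢0)))
  g1≡0⇒outside : InW m γ × g1 γ ≡ 0 → InW m γ × ¬ A0 m γ × ¬ A1 m γ
  g1≡0⇒outside (w , g1≡0) = w , g1≡0⇒¬A0 m γ g1≡0 , InW∧g1≡0⇒¬A1 m γ w g1≡0
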